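{- Let $\mathcal{T}$ be a $\ltimes$-transition system. Then $\mathscr{A}(\mathcal{T})$ is an HDA model of $\mathcal{T}$.
   Context: A precubical set $P$ is a family of sets $(P_n)_{n\ge0}$ with face maps $d^k_i:P_n\to P_{n-1}$ ($n>0$, $k\in\{0,1\}$, $1\le i\le n$) satisfying $d^k_id^l_j=d^l_{j-1}d^k_i$ for $i<j$; morphisms commute with faces; a precubical subset is closed under faces; $P_{\le n}$ is the $n$-skeleton (cubes of degree $\le n$). Tensor product: $(P\otimes Q)_n=\coprod_{p+q=n}P_p\times Q_q$ with $d^k_i(x,y)=(d^k_ix,y)$ for $i\le p$ and $(x,d^k_{i-p}y)$ for $i>p$. $\llbracket0,1\rrbracket$ is the precubical set with vertices $0,1$ and one edge from $0$ to $1$; $\llbracket0,1\rrbracket^{\otimes m}$ is its $m$-fold tensor power with unique $m$-cube $\iota_m$; for $x\in P_m$, $x_\sharp$ is the unique morphism $\llbracket0,1\rrbracket^{\otimes m}\to P$ with $x_\sharp(\iota_m)=x$. $\varGamma_2$ denotes the right adjoint of the 2-truncation functor $P\mapsto P_{\le2}$ from precubical sets to 2-truncated precubical sets (those with no cubes of degree $>2$): $\varGamma_2Q$ agrees with $Q$ in degrees $\le2$, and for $m>2$ its $m$-cubes $x$ correspond bijectively via $x\mapsto(x_\sharp)_{\le2}$ to morphisms $\llbracket0,1\rrbracket^{\otimes m}_{\le2}\to Q$. An HDA is $\mathcal{A}=(P_\mathcal{A},I_\mathcal{A},F_\mathcal{A},\Sigma_\mathcal{A},\lambda_\mathcal{A})$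 with $P_\mathcal{A}$ a precubical set, $I_\mathcal{A}$ a vertex, $F_\mathcal{A}$ a set of vertices, $\lambda_\mathcal{A}:(P_\mathcal{A})_1\to\Sigma_\mathcal{A}$ with $\lambda_\mathcal{A}(d^0_ix)=\lambda_\mathcal{A}(d^1_ix)$ for 2-cubes $x$, $i=1,2$. $\mathcal{B}$ is a subautomaton of $\mathcal{A}$ if $P_\mathcal{B}$ is a precubical subset of $P_\mathcal{A}$, $\Sigma_\mathcal{B}\subseteq\Sigma_\mathcal{A}$, $I_\mathcal{B}=I_\mathcal{A}$, $F_\mathcal{B}\subseteq F_\mathcal{A}$, $\lambda_\mathcal{B}=\lambda_\mathcal{A}$ on $(P_\mathcal{B})_1$. $\mathcal{A}_{\le n}$ is the HDA with precubical set $(P_\mathcal{A})_{\le n}$ and the same other data. A transition system is an HDA without cubes of degree $\ge2$ in which two edges with equal label, equal $d^0_1$ and equal $d^1_1$ coincide. A $\ltimes$-transition system $\mathcal{T}$ is a transition system $U(\mathcal{T})=(P_\mathcal{T},I_\mathcal{T},F_\mathcal{T},\Sigma_\mathcal{T},\lambda_\mathcal{T})$ with an arbitrary binary relation $\ltimes_\mathcal{T}$ on $\Sigma_\mathcal{T}$. An independence square in $\mathcal{T}$ is a family of edges $(x^k_i)_{k\in\{0,1\},i\in\{1,2\}}$ with $d^k_1x^l_2=d^l_1x^k_1$ for all $k,l$ and $\lambda_\mathcal{T}(x^0_2)=\lambda_\mathcal{T}(x^1_2)\ltimes_\mathcal{T}\lambda_\mathcal{T}(x^0_1)=\lambda_\mathcal{T}(x^1_1)$.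 $\varPsi(\mathcal{T})$ is the 2-truncated HDA with $\varPsi(\mathcal{T})_{\le1}=U(\mathcal{T})$, whose 2-cubes are the independence squares with $d^l_j((x^k_i)_{k,i})=x^l_j$. $\mathscr{A}(\mathcal{T})$ is the HDA with precubical set $\varGamma_2(P_{\varPsi(\mathcal{T})})$, initial state $I_\mathcal{T}$, final states $F_\mathcal{T}$, labels $\Sigma_\mathcal{T}$ and labeling $\lambda_\mathcal{T}$. An HDA $\mathcal{A}$ is an HDA model of $\mathcal{T}$ if: (HM1) $\mathcal{A}_{\le1}=U(\mathcal{T})$; (HM2) for all $x\in(P_\mathcal{A})_2$, $\lambda_\mathcal{A}(d^0_2x)\ltimes_\mathcal{T}\lambda_\mathcal{A}(d^0_1x)$; (HM3) for all $m\ge2$ and $x,y\in(P_\mathcal{A})_m$, if $d^k_rx=d^k_ry$ for all $r\in\{1,\dots,m\}$, $k\in\{0,1\}$, then $x=y$; (HM4) $\mathcal{A}$ is not a proper subautomaton of any HDA satisfying HM1–HM3 with respect to $\mathcal{T}$. -}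

module Defs where

open import Level using (0ℓ)
open import Data.Nat using (ℕ; zero; suc; _≤_; s≤s; z≤n)
open import Data.Fin using (Fin; zero; suc; toℕ; inject₁)
open import Data.Bool using (Bool; true; false)
open import Data.Product using (Σ; _×_; _,_; ∃; ∃-syntax)
open import Data.Empty using (⊥)
open import Relation.Nullary using (¬_)
open import Relation.Binary.PropositionalEquality
  using (_≡_; refl; sym; trans; cong; cong₂)
open import Function.Bundles using (_↔_; Inverse; _⇔_)
open import Axiom.Extensionality.Propositional using (Extensionality)
open import Axiom.UniquenessOfIdentityProofs.WithK using (uip)

-- Conventions
--   * k ∈ {0,1} is a Bool (false = 0, true = 1).
--   * face index i ∈ {1,…,n} is an element of Fin n, 0-based
--     (Fin-element r stands for the paper's index r+1).
--   * The precubical identity  d^k_i d^l_j = d^l_{j-1} d^k_i  (i < j)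
--     on (n+2)-cubes is written, with 0-based i ≤ j', j = j'+1, as
--       d k i (d l (suc j') x) ≡ d l j' (d k (inject₁ i) x).

record PSet : Set₁ where
  field
    C   : ℕ → Set
    d   : ∀ {n} → Bool → Fin (suc n) → C (suc n) → C n
    rel : ∀ {n} (k l : Bool) (i j : Fin (suc n)) → toℕ i ≤ toℕ j →
          (x : C (suc (suc n))) →
          d k i (d l (suc j) x) ≡ d l j (d k (inject₁ i) x)

record PSet2 : Set₁ where
  field
    C0  : Set
    C1  : Set
    C2  : Set
    d1  : Bool → Fin 1 → C1 → C0
    d2  : Bool → Fin 2 → C2 → C1
    rel : (k l : Bool) (i j : Fin 1) → toℕ i ≤ toℕ j → (x : C2) →
          d1 k i (d2 l (suc j) x) ≡ d1 l j (d2 k (inject₁ i) x)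

-- The standard cube ⟦0,1⟧^{⊗m}, with ⟦0,1⟧^{⊗0} the one-point precubical
-- set and ⟦0,1⟧^{⊗(m+1)} = ⟦0,1⟧ ⊗ ⟦0,1⟧^{⊗m}.  Unfolding the tensor
-- product: an n-cube of ⟦0,1⟧ ⊗ X is either (vertex b, x) with x ∈ X_n or
-- (edge, x) with x ∈ X_{n-1}.  Cube m n = the n-cubes of ⟦0,1⟧^{⊗m}.

data Cube : ℕ → ℕ → Set where
  []   : Cube 0 0
  _∷v_ : ∀ {m n} → Bool → Cube m n → Cube (suc m) n
  e∷_  : ∀ {m n} → Cube m n → Cube (suc m) (suc n)

-- faces, following the tensor product formula
cd : ∀ {m n} → Bool → Fin (suc n) → Cube m (suc n) → Cube m n
cd k i (b ∷v x)       = b ∷v cd k i x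
cd k zero (e∷ x)      = k ∷v x
cd {n = suc n} k (suc i) (e∷ x) = e∷ cd k i x

cubeRel : ∀ {m n} (k l : Bool) (i j : Fin (suc n)) → toℕ i ≤ toℕ j →
          (x : Cube m (suc (suc n))) →
          cd k i (cd l (suc j) x) ≡ cd l j (cd k (inject₁ i) x)
cubeRel k l i j h (b ∷v x)                 = cong (b ∷v_) (cubeRel k l i j h x)
cubeRel k l zero j h (e∷ x)                = refl
cubeRel {n = suc n} k l (suc i) (suc j) (s≤s h) (e∷ x) = cong e∷_ (cubeRel k l i j h x)

Cubes : ℕ → PSet
Cubes m = record { C = Cube m ; d = cd ; rel = cubeRel }

ι : ∀ m → Cube m m
ι zero    = []
ι (suc m) = e∷ ι m

-- x_♯ : ⟦0,1⟧^{⊗m} → ⟦0,1⟧^{⊗M} for x an m-cube of ⟦0,1⟧^{⊗M}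
sharp : ∀ {M m n} → Cube M m → Cube m n → Cube M n
sharp [] []               = []
sharp (b ∷v x) y          = b ∷v sharp x y
sharp (e∷ x) (b ∷v y)     = b ∷v sharp x y
sharp (e∷ x) (e∷ y)       = e∷ sharp x y

sharp-cd : ∀ {M m n} (x : Cube M m) (k : Bool) (i : Fin (suc n))
           (y : Cube m (suc n)) → sharp x (cd k i y) ≡ cd k i (sharp x y)
sharp-cd (b ∷v x) k i y             = cong (b ∷v_) (sharp-cd x k i y)
sharp-cd (e∷ x) k i (c ∷v y)        = cong (c ∷v_) (sharp-cd x k i y)
sharp-cd (e∷ x) k zero (e∷ y)       = refl
sharp-cd {n = suc n} (e∷ x) k (suc i) (e∷ y) = cong e∷_ (sharp-cd x k i y)

sharp-ι : ∀ {M m} (x : Cube M m) → sharp x (ι m) ≡ x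
sharp-ι []       = refl
sharp-ι (b ∷v x) = cong (b ∷v_) (sharp-ι x)
sharp-ι (e∷ x)   = cong e∷_ (sharp-ι x)

sharp-assoc : ∀ {M m p n} (x : Cube M m) (y : Cube m p) (z : Cube p n) →
              sharp x (sharp y z) ≡ sharp (sharp x y) z
sharp-assoc [] [] []                  = refl
sharp-assoc (b ∷v x) y z              = cong (b ∷v_) (sharp-assoc x y z)
sharp-assoc (e∷ x) (c ∷v y) z         = cong (c ∷v_) (sharp-assoc x y z)
sharp-assoc (e∷ x) (e∷ y) (c ∷v z)    = cong (c ∷v_) (sharp-assoc x y z)
sharp-assoc (e∷ x) (e∷ y) (e∷ z)      = cong e∷_ (sharp-assoc x y z)

sharp-cdι : ∀ {M m n} (x : Cube M (suc m)) (k : Bool) (i : Fin (suc m))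
            (z : Cube m n) → sharp x (sharp (cd k i (ι (suc m))) z) ≡ sharp (cd k i x) z
sharp-cdι {m = m} x k i z =
  trans (sharp-assoc x (cd k i (ι (suc m))) z)
        (cong (λ w → sharp w z)
              (trans (sharp-cd x k i (ι (suc m))) (cong (cd k i) (sharp-ι x))))

sharp-cd1 : ∀ {M m} (x : Cube M (suc m)) (k : Bool) (i : Fin (suc m)) →
            sharp x (cd k i (ι (suc m))) ≡ cd k i x
sharp-cd1 {m = m} x k i =
  trans (sharp-cd x k i (ι (suc m))) (cong (cd k i) (sharp-ι x))

-- Morphisms ⟦0,1⟧^{⊗m}_{≤2} → Q  (Q 2-truncated)

record Mor2 (Q : PSet2) (m : ℕ) : Set where
  constructor mor2
  open PSet2 Q
  field
    f0 : Cube m 0 → C0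
    f1 : Cube m 1 → C1
    f2 : Cube m 2 → C2
    c1 : (k : Bool) (i : Fin 1) (x : Cube m 1) → f0 (cd k i x) ≡ d1 k i (f1 x)
    c2 : (k : Bool) (i : Fin 2) (x : Cube m 2) → f1 (cd k i x) ≡ d2 k i (f2 x)

module _ {Q : PSet2} where
  open PSet2 Q
  open Mor2

  pre : ∀ {M m} → Mor2 Q M → Cube M m → Mor2 Q m
  pre f x = mor2 (λ y → f0 f (sharp x y)) (λ y → f1 f (sharp x y))
                 (λ y → f2 f (sharp x y))
                 (λ k i y → trans (cong (f0 f) (sharp-cd x k i y)) (c1 f k i (sharp x y)))
                 (λ k i y → trans (cong (f1 f) (sharp-cd x k i y)) (c2 f k i (sharp x y)))

  mor-ext : Extensionality 0ℓ 0ℓ → ∀ {m} (a b : Mor2 Q m) →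
            (∀ y → f0 a y ≡ f0 b y) → (∀ y → f1 a y ≡ f1 b y) →
            (∀ y → f2 a y ≡ f2 b y) → a ≡ b
  mor-ext ext (mor2 f0 f1 f2 c1 c2) (mor2 g0 g1 g2 e1 e2) p0 p1 p2
    with ext p0 | ext p1 | ext p2
  ... | refl | refl | refl =
    cong₂ (mor2 f0 f1 f2)
          (ext λ k → ext λ i → ext λ x → uip _ _)
          (ext λ k → ext λ i → ext λ x → uip _ _)

-- Γ₂ : right adjoint of 2-truncation.  Degrees ≤ 2 as in Q; for m > 2 the
-- m-cubes are the morphisms ⟦0,1⟧^{⊗m}_{≤2} → Q; faces are given by
-- precomposition with (d^k_i ι_m)_♯ (the unique structure making
-- x ↦ (x_♯)_{≤2} a bijection compatible with faces).
-- (Function extensionality is needed to verify the precubical identities.)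

module Gamma2 (ext : Extensionality 0ℓ 0ℓ) (Q : PSet2) where
  open PSet2 Q
  open Mor2

  G : ℕ → Set
  G zero                   = C0
  G (suc zero)             = C1
  G (suc (suc zero))       = C2
  G (suc (suc (suc m)))    = Mor2 Q (suc (suc (suc m)))

  Gd : ∀ {n} → Bool → Fin (suc n) → G (suc n) → G n
  Gd {zero} k i x                = d1 k i x
  Gd {suc zero} k i x            = d2 k i x
  Gd {suc (suc zero)} k i f      = f2 f (cd k i (ι 3))
  Gd {suc (suc (suc m))} k i f   = pre f (cd k i (ι (suc (suc (suc (suc m))))))

  Grel : ∀ {n} (k l : Bool) (i j : Fin (suc n)) → toℕ i ≤ toℕ j →
         (x : G (suc (suc n))) →
         Gd k i (Gd l (suc j) x) ≡ Gd l j (Gd k (inject₁ i) x)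
  Grel {zero} k l i j h x = rel k l i j h x
  Grel {suc zero} k l i j h x =
    trans (sym (c2 x k i (cd l (suc j) (ι 3))))
          (trans (cong (f1 x) (cubeRel k l i j h (ι 3)))
                 (c2 x l j (cd k (inject₁ i) (ι 3))))
  Grel {suc (suc zero)} k l i j h x =
    trans (cong (f2 x) (sharp-cd1 (cd l (suc j) (ι 4)) k i))
          (trans (cong (f2 x) (cubeRel k l i j h (ι 4)))
                 (sym (cong (f2 x) (sharp-cd1 (cd k (inject₁ i) (ι 4)) l j))))
  Grel {suc (suc (suc m))} k l i j h x =
    mor-ext ext _ _ (λ y → cong (f0 x) (eq y)) (λ y → cong (f1 x) (eq y))
                    (λ y → cong (f2 x) (eq y))
    where
      N = suc (suc (suc (suc (suc m))))
      eq : ∀ {p} (y : Cube (suc (suc (suc m))) p) →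
           sharp (cd l (suc j) (ι N)) (sharp (cd k i (ι (suc (suc (suc (suc m)))))) y)
           ≡ sharp (cd k (inject₁ i) (ι N)) (sharp (cd l j (ι (suc (suc (suc (suc m)))))) y)
      eq y = trans (sharp-cdι (cd l (suc j) (ι N)) k i y)
               (trans (cong (λ w → sharp w y) (cubeRel k l i j h (ι N)))
                      (sym (sharp-cdι (cd k (inject₁ i) (ι N)) l j y)))

  Γ₂ : PSet
  Γ₂ = record { C = G ; d = Gd ; rel = Grel }

record HDA : Set₁ where
  field
    P     : PSet
  open PSet P public
  field
    I     : C 0
    F     : C 0 → Set
    Lab   : Set
    lab   : C 1 → Lab
    lab-ok : (x : C 2) (i : Fin 2) → lab (d false i x) ≡ lab (d true i x)

record IsTS (U : HDA) : Set where
  open HDA U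
  field
    no-high : ∀ n → ¬ C (suc (suc n))
    det     : (x y : C 1) → lab x ≡ lab y →
              d false zero x ≡ d false zero y →
              d true zero x ≡ d true zero y → x ≡ y

record ⋉TS : Set₁ where
  field
    U    : HDA
    isTS : IsTS U
  open HDA U public
  field
    _⋉_  : Lab → Lab → Set
    -- a binary relation (a subset of Σ × Σ): membership is a proposition
    ⋉-prop : ∀ {a b} (p q : a ⋉ b) → p ≡ q

module _ (T : ⋉TS) where
  open ⋉TS T

  -- independence squares: x k i ↦ fields xki (k ∈ {0,1}, i ∈ {1,2})
  record ISq : Set where
    constructor isq
    field
      x01 x02 x11 x12 : C 1
      -- d^k_1 x^l_2 = d^l_1 x^k_1 for all k, l
      b00 : d false zero x02 ≡ d false zero x01
      b01 : d false zero x12 ≡ d true zero x01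
      b10 : d true zero x02 ≡ d false zero x11
      b11 : d true zero x12 ≡ d true zero x11
      l2  : lab x02 ≡ lab x12
      ind : lab x02 ⋉ lab x01
      l1  : lab x01 ≡ lab x11

  sqd : Bool → Fin 2 → ISq → C 1
  sqd false zero s       = ISq.x01 s
  sqd false (suc zero) s = ISq.x02 s
  sqd true zero s        = ISq.x11 s
  sqd true (suc zero) s  = ISq.x12 s

  sqrel : (k l : Bool) (i j : Fin 1) → toℕ i ≤ toℕ j → (x : ISq) →
          d k i (sqd l (suc j) x) ≡ d l j (sqd k (inject₁ i) x)
  sqrel false false zero zero h s = ISq.b00 s
  sqrel false true  zero zero h s = ISq.b01 s
  sqrel true  false zero zero h s = ISq.b10 s
  sqrel true  true  zero zero h s = ISq.b11 s

  ΨP : PSet2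
  ΨP = record { C0 = C 0 ; C1 = C 1 ; C2 = ISq
              ; d1 = d ; d2 = sqd ; rel = sqrel }

  sqlab : (s : ISq) (i : Fin 2) → lab (sqd false i s) ≡ lab (sqd true i s)
  sqlab s zero       = ISq.l1 s
  sqlab s (suc zero) = ISq.l2 s

  𝒜 : Extensionality 0ℓ 0ℓ → HDA
  𝒜 ext = record
    { P = Gamma2.Γ₂ ext ΨP
    ; I = I ; F = F ; Lab = Lab ; lab = lab ; lab-ok = sqlab }

-- (HM1)  𝒜_{≤1} = U(T): the vertices, edges, labels of 𝒜 are identified
-- with those of U(T), compatibly with faces, initial/final states, labels.
record HM1 (T : ⋉TS) (A : HDA) : Set where
  private
    module T = ⋉TS T
    module A = HDA A
  field
    v   : A.C 0 ↔ T.C 0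
    e   : A.C 1 ↔ T.C 1
    σ   : A.Lab ↔ T.Lab
    face : (k : Bool) (i : Fin 1) (x : A.C 1) →
           Inverse.to v (A.d k i x) ≡ T.d k i (Inverse.to e x)
    init : Inverse.to v A.I ≡ T.I
    fin  : (x : A.C 0) → A.F x ⇔ T.F (Inverse.to v x)
    labs : (x : A.C 1) → Inverse.to σ (A.lab x) ≡ T.lab (Inverse.to e x)

HM2 : (T : ⋉TS) (A : HDA) → HM1 T A → Set
HM2 T A φ = (x : C 2) →
  Inverse.to σ (lab (d false (suc zero) x)) ⋉ Inverse.to σ (lab (d false zero x))
  where open HDA A
        open HM1 φ
        open ⋉TS T using (_⋉_)

-- (HM3)  for m = n + 2 ≥ 2
HM3 : HDA → Set
HM3 A = ∀ n (x y : C (suc (suc n))) →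
        ((k : Bool) (r : Fin (suc (suc n))) → d k r x ≡ d k r y) → x ≡ y
  where open HDA A

record Sub (B A : HDA) : Set where
  private
    module A = HDA A
    module B = HDA B
  field
    inc    : ∀ n → B.C n → A.C n
    inc-inj  : ∀ n (x y : B.C n) → inc n x ≡ inc n y → x ≡ y
    inc-face : ∀ n (k : Bool) (i : Fin (suc n)) (x : B.C (suc n)) →
             inc n (B.d k i x) ≡ A.d k i (inc (suc n) x)
    σ      : B.Lab → A.Lab
    σ-inj  : ∀ a b → σ a ≡ σ b → a ≡ b
    init   : inc 0 B.I ≡ A.I
    fin    : ∀ x → B.F x → A.F (inc 0 x)
    labs   : ∀ x → σ (B.lab x) ≡ A.lab (inc 1 x)

Proper : {B A : HDA} → Sub B A → Set
Proper {B} {A} s =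
  ¬ ( (∀ n (y : HDA.C A n) → ∃[ x ] inc n x ≡ y)
    × (∀ (b : HDA.Lab A) → ∃[ a ] σ a ≡ b)
    × (∀ x → HDA.F A (inc 0 x) → HDA.F B x) )
  where open Sub s

-- the inclusion A ⊆ B restricts to the identity of U(T) on 1-skeleta
-- (both being identified with U(T) by HM1)
Compatible : {T : ⋉TS} {A B : HDA} → HM1 T A → HM1 T B → Sub A B → Set
Compatible φ ψ s =
    (∀ x → Inverse.to (HM1.v ψ) (Sub.inc s 0 x) ≡ Inverse.to (HM1.v φ) x)
  × (∀ x → Inverse.to (HM1.e ψ) (Sub.inc s 1 x) ≡ Inverse.to (HM1.e φ) x)
  × (∀ a → Inverse.to (HM1.σ ψ) (Sub.σ s a) ≡ Inverse.to (HM1.σ φ) a)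

HM4 : (T : ⋉TS) (A : HDA) → HM1 T A → Set₁
HM4 T A φ = ¬ Σ HDA λ B → Σ (HM1 T B) λ ψ → HM2 T B ψ × HM3 B ×
              Σ (Sub A B) λ s → Compatible φ ψ s × Proper s

record IsHDAModel (T : ⋉TS) (A : HDA) : Set₁ where
  field
    hm1 : HM1 T A
    hm2 : HM2 T A hm1
    hm3 : HM3 A
    hm4 : HM4 T A hm1

module Submission where

-- Proof idea: HM1 and HM2 hold by construction, and HM3 holds because a
-- cube of Γ₂ is determined by its 2-dimensional faces.  For HM4, let B
-- satisfy HM1–HM3 and contain 𝒜(T).  By HM1 and HM2 the 2-skeleton of B
-- maps to Ψ(T), so by the adjunction (-)_{≤2} ⊣ Γ₂ the whole of B maps to
-- 𝒜(T); by HM3 for B and induction on degree, this map is a section of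
-- the inclusion, which is therefore onto, and B = 𝒜(T).

open import Defs
open import Level using (0ℓ)
open import Axiom.Extensionality.Propositional using (Extensionality)
open import Axiom.UniquenessOfIdentityProofs.WithK using (uip)
open import Data.Nat using (zero; suc; _≤_; _<_; s≤s; z≤n)
open import Data.Nat.Properties using (m≤n⇒m≤1+n; <-irrefl)
open import Data.Fin using (Fin; zero; suc)
open import Data.Bool using (Bool; true; false)
open import Data.Product using (_,_; ∃-syntax)
open import Data.Empty using (⊥-elim)
open import Relation.Binary.PropositionalEquality
  using (_≡_; refl; sym; trans; cong; subst; subst₂; module ≡-Reasoning)
open import Function.Bundles using (_↔_; Inverse; Equivalence; Injection)
open import Function.Construct.Identity using (↔-id; ⇔-id)
open import Function.Properties.Inverse using (Inverse⇒Injection)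

open PSet using (C)

record Hom (P Q : PSet) : Set where
  field
    map   : ∀ {n} → C P n → C Q n
    map-d : ∀ {n} k i (x : C P (suc n)) → map (PSet.d P k i x) ≡ PSet.d Q k i (map x)

-- The cubes of degree ≥ 1, with every face but the first: x_♯ on
-- e∷ z uses only these, which is what makes x_♯ structurally recursive.
shift : PSet → PSet
shift P = record
  { C   = λ n → C P (suc n)
  ; d   = λ k i → d k (suc i)
  ; rel = λ k l i j i≤j → rel k l (suc i) (suc j) (s≤s i≤j)
  } where open PSet P

shift-Hom : ∀ {P Q} → Hom P Q → Hom (shift P) (shift Q)
shift-Hom h = record { map = map ; map-d = λ k i → map-d k (suc i) }
  where open Hom h

d₁-Hom : (P : PSet) (k : Bool) → Hom (shift P) P
d₁-Hom P k = record { map = d k zero ; map-d = λ l i → rel k l zero i z≤n }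
  where open PSet P

_♯ : ∀ {P : PSet} {m n} → C P m → Cube m n → C P n
_♯ {P} x []       = x
_♯ {P} x (b ∷v z) = _♯ {P} (PSet.d P b zero x) z
_♯ {P} x (e∷ z)   = _♯ {shift P} x z

♯-natural : ∀ {P Q} (h : Hom P Q) {m n} (x : C P m) (z : Cube m n) →
            _♯ {Q} (Hom.map h x) z ≡ Hom.map h (_♯ {P} x z)
♯-natural h x []               = refl
♯-natural {P} {Q} h x (b ∷v z) =
  trans (cong (λ y → _♯ {Q} y z) (sym (Hom.map-d h b zero x)))
        (♯-natural h (PSet.d P b zero x) z)
♯-natural h x (e∷ z)           = ♯-natural (shift-Hom h) x z

♯-cd : ∀ {P : PSet} {m n} k (i : Fin (suc n)) (x : C P m) (z : Cube m (suc n)) →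
       _♯ {P} x (cd k i z) ≡ PSet.d P k i (_♯ {P} x z)
♯-cd {P} k i x (b ∷v z)                 = ♯-cd {P} k i (PSet.d P b zero x) z
♯-cd {P} k zero x (e∷ z)                = ♯-natural (d₁-Hom P k) x z
♯-cd {P} {n = suc n} k (suc i) x (e∷ z) = ♯-cd {shift P} k i x z

♯-ι : ∀ {P : PSet} {m} (x : C P m) → _♯ {P} x (ι m) ≡ x
♯-ι {P} {zero}  x = refl
♯-ι {P} {suc m} x = ♯-ι {shift P} x

♯-sharp : ∀ {P : PSet} {M m n} (x : C P M) (c : Cube M m) (z : Cube m n) →
          _♯ {P} x (sharp c z) ≡ _♯ {P} (_♯ {P} x c) z
♯-sharp {P} x [] [] = refl
♯-sharp {P} x (b ∷v c) z = ♯-sharp {P} (PSet.d P b zero x) c z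
♯-sharp {P} x (e∷ c) (b ∷v z) =
  trans (♯-sharp {P} (PSet.d P b zero x) c z)
        (cong (λ y → _♯ {P} y z) (♯-natural (d₁-Hom P b) x c))
♯-sharp {P} x (e∷ c) (e∷ z) = ♯-sharp {shift P} x c z

♯-face : ∀ {P : PSet} {m} k (i : Fin (suc m)) (x : C P (suc m)) →
         _♯ {P} x (cd k i (ι (suc m))) ≡ PSet.d P k i x
♯-face {P} k i x = trans (♯-cd {P} k i x (ι _)) (cong (PSet.d P k i) (♯-ι {P} x))

Cube-dim : ∀ {m n} → Cube m n → n ≤ m
Cube-dim []       = z≤n
Cube-dim (b ∷v z) = m≤n⇒m≤1+n (Cube-dim z)
Cube-dim (e∷ z)   = s≤s (Cube-dim z)

ι-unique : ∀ {m} (z : Cube m m) → z ≡ ι m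
ι-unique []       = refl
ι-unique (b ∷v z) = ⊥-elim (<-irrefl refl (Cube-dim z))
ι-unique (e∷ z)   = cong e∷_ (ι-unique z)

cd-surjective : ∀ {m n} (y : Cube m n) → n < m →
                ∃[ k ] ∃[ i ] ∃[ z ] cd k i z ≡ y
cd-surjective (b ∷v y) n<m       = b , zero , e∷ y , refl
cd-surjective (e∷ y) (s≤s n<m) with cd-surjective y n<m
... | k , i , z , refl = k , suc i , e∷ z , refl

sharp-ιˡ : ∀ {m n} (y : Cube m n) → sharp (ι m) y ≡ y
sharp-ιˡ []       = refl
sharp-ιˡ (b ∷v y) = cong (b ∷v_) (sharp-ιˡ y)
sharp-ιˡ (e∷ y)   = cong e∷_ (sharp-ιˡ y)

sharp-facet-surjective : ∀ {m n} (y : Cube (suc m) n) → n ≤ m →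
  ∃[ k ] ∃[ i ] ∃[ z ] sharp (cd k i (ι (suc m))) z ≡ y
sharp-facet-surjective (b ∷v y) n≤m       = b , zero , y , cong (b ∷v_) (sharp-ιˡ y)
sharp-facet-surjective (e∷ y) (s≤s n≤m) with sharp-facet-surjective y n≤m
... | k , i , z , refl = k , suc i , e∷ z , refl

module Γ₂-Properties (ext : Extensionality 0ℓ 0ℓ) (Q : PSet2) where
  open PSet2 Q
  open Gamma2 ext Q
  open Mor2

  Mor2-≡-from-f2 : ∀ {m} (f g : Mor2 Q (suc (suc m))) → (∀ z → f2 f z ≡ f2 g z) → f ≡ g
  Mor2-≡-from-f2 f g f2≡ = mor-ext ext f g f0≡ f1≡ f2≡
    where
      f1≡ : ∀ z → f1 f z ≡ f1 g z
      f1≡ z with cd-surjective z (s≤s (s≤s z≤n))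
      ... | k , i , w , refl = trans (c2 f k i w) (trans (cong (d2 k i) (f2≡ w)) (sym (c2 g k i w)))
      f0≡ : ∀ z → f0 f z ≡ f0 g z
      f0≡ z with cd-surjective z (s≤s z≤n)
      ... | k , i , w , refl = trans (c1 f k i w) (trans (cong (d1 k i) (f1≡ w)) (sym (c1 g k i w)))

  Gd-injective : ∀ n (x y : G (suc (suc (suc n)))) →
                 (∀ k r → Gd {suc (suc n)} k r x ≡ Gd k r y) → x ≡ y
  Gd-injective zero x y faces≡ = Mor2-≡-from-f2 x y f2≡
    where
      f2≡ : ∀ z → f2 x z ≡ f2 y z
      f2≡ z with cd-surjective z (s≤s (s≤s (s≤s z≤n)))
      ... | k , i , w , refl with ι-unique w
      ... | refl = faces≡ k i
  Gd-injective (suc n) x y faces≡ = Mor2-≡-from-f2 x y f2≡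
    where
      f2≡ : ∀ z → f2 x z ≡ f2 y z
      f2≡ z with sharp-facet-surjective z (s≤s (s≤s z≤n))
      ... | k , i , w , refl = cong (λ g → f2 g w) (faces≡ k i)

  record Hom≤2 (P : PSet) : Set where
    open PSet P using (d)
    field
      h0   : C P 0 → C0
      h1   : C P 1 → C1
      h2   : C P 2 → C2
      h1-d : ∀ k i (x : C P 1) → h0 (d k i x) ≡ d1 k i (h1 x)
      h2-d : ∀ k i (x : C P 2) → h1 (d k i x) ≡ d2 k i (h2 x)

  -- The transpose under the adjunction (-)_{≤2} ⊣ Γ₂: an m-cube x goes
  -- to the restriction of h along x_♯.
  transpose : ∀ {P} → Hom≤2 P → Hom P Γ₂
  transpose {P} h = record { map = map ; map-d = map-d }
    where
      open Hom≤2 h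
      open PSet P using (d)

      map : ∀ {n} → C P n → G n
      map {zero}            = h0
      map {suc zero}        = h1
      map {suc (suc zero)}  = h2
      map {suc (suc (suc m))} x = mor2 (λ z → h0 (_♯ {P} x z)) (λ z → h1 (_♯ {P} x z))
        (λ z → h2 (_♯ {P} x z))
        (λ k i z → trans (cong h0 (♯-cd {P} k i x z)) (h1-d k i (_♯ {P} x z)))
        (λ k i z → trans (cong h1 (♯-cd {P} k i x z)) (h2-d k i (_♯ {P} x z)))

      map-d : ∀ {n} k i (x : C P (suc n)) → map (d k i x) ≡ Gd k i (map x)
      map-d {zero}           k i x = h1-d k i x
      map-d {suc zero}       k i x = h2-d k i x
      map-d {suc (suc zero)} k i x = cong h2 (sym (♯-face {P} k i x))
      map-d {suc (suc (suc m))} k i x =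
        mor-ext ext _ _ (λ z → cong h0 (♯-facet z)) (λ z → cong h1 (♯-facet z))
                        (λ z → cong h2 (♯-facet z))
        where
          ♯-facet : ∀ {p} (z : Cube (suc (suc (suc m))) p) →
                    _♯ {P} (d k i x) z ≡ _♯ {P} x (sharp (cd k i (ι _)) z)
          ♯-facet z = trans (cong (λ y → _♯ {P} y z) (sym (♯-face {P} k i x)))
                            (sym (♯-sharp {P} x (cd k i (ι _)) z))

Sub-rightInverse : ∀ {A B} (s : Sub A B) → HM3 B → (θ : Hom (HDA.P B) (HDA.P A)) →
  (∀ w → Sub.inc s 0 (Hom.map θ w) ≡ w) → (∀ w → Sub.inc s 1 (Hom.map θ w) ≡ w) →
  ∀ n w → Sub.inc s n (Hom.map θ w) ≡ w
Sub-rightInverse s hm3 θ inc∘θ₀ inc∘θ₁ zero             = inc∘θ₀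
Sub-rightInverse s hm3 θ inc∘θ₀ inc∘θ₁ (suc zero)       = inc∘θ₁
Sub-rightInverse {A} {B} s hm3 θ inc∘θ₀ inc∘θ₁ (suc (suc n)) w = hm3 n _ _ λ k r →
  begin
    HDA.d B k r (inc (suc (suc n)) (map w)) ≡⟨ sym (inc-face (suc n) k r (map w)) ⟩
    inc (suc n) (HDA.d A k r (map w))       ≡⟨ cong (inc (suc n)) (sym (map-d k r w)) ⟩
    inc (suc n) (map (HDA.d B k r w))       ≡⟨ Sub-rightInverse s hm3 θ inc∘θ₀ inc∘θ₁ (suc n) _ ⟩
    HDA.d B k r w                           ∎
  where
    open ≡-Reasoning
    open Sub s
    open Hom θ

module _ (ext : Extensionality 0ℓ 0ℓ) (T : ⋉TS) where
  open ⋉TS T using (_⋉_; ⋉-prop)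
  open Γ₂-Properties ext (ΨP T)
  private
    module T = ⋉TS T

  𝒜-hm1 : HM1 T (𝒜 T ext)
  𝒜-hm1 = record
    { v = ↔-id _ ; e = ↔-id _ ; σ = ↔-id _
    ; face = λ _ _ _ → refl ; init = refl
    ; fin = λ _ → ⇔-id _ ; labs = λ _ → refl }

  𝒜-hm2 : HM2 T (𝒜 T ext) 𝒜-hm1
  𝒜-hm2 = ISq.ind

  ISq-faces-injective : (s t : ISq T) → (∀ k r → sqd T k r s ≡ sqd T k r t) → s ≡ t
  ISq-faces-injective (isq _ _ _ _ b00 b01 b10 b11 l2 ind l1)
                      (isq _ _ _ _ b00′ b01′ b10′ b11′ l2′ ind′ l1′) faces≡
    with faces≡ false zero | faces≡ false (suc zero) | faces≡ true zero | faces≡ true (suc zero)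
  ... | refl | refl | refl | refl
    with uip b00 b00′ | uip b01 b01′ | uip b10 b10′ | uip b11 b11′
       | uip l2 l2′ | uip l1 l1′ | ⋉-prop ind ind′
  ... | refl | refl | refl | refl | refl | refl | refl = refl

  𝒜-hm3 : HM3 (𝒜 T ext)
  𝒜-hm3 zero    = ISq-faces-injective
  𝒜-hm3 (suc n) = Gd-injective n

  module _ (B : HDA) (ψ : HM1 T B) (hm2 : HM2 T B ψ) where
    private
      module B = HDA B
      module ψ = HM1 ψ

    skeleton→Ψ : Hom≤2 B.P
    skeleton→Ψ = record
      { h0 = Inverse.to ψ.v ; h1 = E ; h2 = square
      ; h1-d = ψ.face ; h2-d = square-faces }
      where
        E = Inverse.to ψ.e

        corner : ∀ k l (w : B.C 2) → T.d k zero (E (B.d l (suc zero) w)) ≡ T.d l zero (E (B.d k zero w))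
        corner k l w = trans (sym (ψ.face k zero _))
                         (trans (cong (Inverse.to ψ.v) (B.rel k l zero zero z≤n w)) (ψ.face l zero _))

        opposite-labels : ∀ (w : B.C 2) i → T.lab (E (B.d false i w)) ≡ T.lab (E (B.d true i w))
        opposite-labels w i = trans (sym (ψ.labs _))
                                (trans (cong (Inverse.to ψ.σ) (B.lab-ok w i)) (ψ.labs _))

        square : B.C 2 → ISq T
        square w = isq (E (B.d false zero w)) (E (B.d false (suc zero) w))
                       (E (B.d true zero w)) (E (B.d true (suc zero) w))
                       (corner false false w) (corner false true w) (corner true false w) (corner true true w)
                       (opposite-labels w (suc zero))
                       (subst₂ _⋉_ (ψ.labs _) (ψ.labs _) (hm2 w))
                       (opposite-labels w zero)

        square-faces : ∀ k i (w : B.C 2) → E (B.d k i w) ≡ sqd T k i (square w)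
        square-faces false zero       w = refl
        square-faces false (suc zero) w = refl
        square-faces true  zero       w = refl
        square-faces true  (suc zero) w = refl

  𝒜-hm4 : HM4 T (𝒜 T ext) 𝒜-hm1
  𝒜-hm4 (B , ψ , hm2 , hm3 , s , (inc₀ , inc₁ , incσ) , proper) =
    proper (inc-surjective , σ-surjective , F-reflected)
    where
      module ψ = HM1 ψ
      open Sub s
      θ = transpose (skeleton→Ψ B ψ hm2)

      injective : ∀ {X Y : Set} (f : X ↔ Y) {x y} → Inverse.to f x ≡ Inverse.to f y → x ≡ y
      injective f = Injection.injective (Inverse⇒Injection f)

      inc-surjective : ∀ n w → ∃[ x ] inc n x ≡ w
      inc-surjective n w = Hom.map θ w , Sub-rightInverse s hm3 θ
        (λ w → injective ψ.v (inc₀ _)) (λ w → injective ψ.e (inc₁ _)) n w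

      σ-surjective : ∀ b → ∃[ a ] σ a ≡ b
      σ-surjective b = Inverse.to ψ.σ b , injective ψ.σ (incσ _)

      F-reflected : ∀ x → HDA.F B (inc 0 x) → T.F x
      F-reflected x Fx = subst T.F (inc₀ x) (Equivalence.to (ψ.fin (inc 0 x)) Fx)

theorem4p2 : (ext : Extensionality 0ℓ 0ℓ) (T : ⋉TS) → IsHDAModel T (𝒜 T ext)
theorem4p2 ext T = record
  { hm1 = 𝒜-hm1 ext T ; hm2 = 𝒜-hm2 ext T ; hm3 = 𝒜-hm3 ext T ; hm4 = 𝒜-hm4 ext T }
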